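{- Let $p$ be a pattern of length $m$ over a finite alphabet $\Sigma$ and let $c=\gcd(\mathbf{Period}(p))$. Then for every $n\in\mathbb{N}$, $D_p(n)\le n-(n \bmod c)$.
   Context: Strings are indexed from 1. For $1\le k\le m$, $p$ is $k$-periodic if $p[i]=p[i+k]$ for all $1\le i\le m-k$; $\mathbf{Period}(p)$ is the set of all periods of $p$ (it contains $m$). $D_p(n)$ is the deterministic decision tree complexity of deciding whether $p$ occurs as a contiguous substring of an unknown $s\in\Sigma^n$: the minimum over all deterministic adaptive query algorithms that correctly decide this, of the worst-case (over $s\in\Sigma^n$) number of characters of $s$ queried. -}

module Defs where

open import Data.Nat using (ℕ; zero; suc; _+_; _≤_; _<_)
open import Data.Nat.Divisibility using (_∣_)
open import Data.Fin using (Fin; fromℕ<)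
open import Data.Bool using (Bool; true)
open import Data.Product using (_×_; ∃)
open import Relation.Binary.PropositionalEquality using (_≡_)
open import Function.Bundles using (_⇔_)

-- Strings are represented as functions from (0-based) positions: a string of
-- length n over Σ is  Fin n → Σ.  Position i here is position i+1 in the paper.

IsPeriod : {Σ : Set} {m : ℕ} → (Fin m → Σ) → ℕ → Set
IsPeriod {m = m} p k =
  (1 ≤ k) × (k ≤ m) ×
  (∀ (i : ℕ) (i<m : i < m) (ik<m : i + k < m) → p (fromℕ< i<m) ≡ p (fromℕ< ik<m))

IsGcdOfPeriods : {Σ : Set} {m : ℕ} → (Fin m → Σ) → ℕ → Set
IsGcdOfPeriods p c =
  (∀ k → IsPeriod p k → c ∣ k) ×
  (∀ d → (∀ k → IsPeriod p k → d ∣ k) → d ∣ c)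

Occurs : {Σ : Set} {m n : ℕ} → (Fin m → Σ) → (Fin n → Σ) → Set
Occurs {m = m} {n = n} p s =
  ∃ λ j → (j + m ≤ n) ×
    (∀ (i : ℕ) (i<m : i < m) (ji<n : j + i < n) → s (fromℕ< ji<n) ≡ p (fromℕ< i<m))

-- Deterministic adaptive query algorithms on inputs s : Fin n → Σ
-- (decision trees): either output an answer, or query a position and
-- continue depending on the character read.
data DTree (Σ : Set) (n : ℕ) : Set where
  leaf  : Bool → DTree Σ n
  query : Fin n → (Σ → DTree Σ n) → DTree Σ n

eval : {Σ : Set} {n : ℕ} → DTree Σ n → (Fin n → Σ) → Bool
eval (leaf b) s = b
eval (query i k) s = eval (k (s i)) s

data DepthAtMost {Σ : Set} {n : ℕ} : DTree Σ n → ℕ → Set where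
  leaf≤  : ∀ {b d} → DepthAtMost (leaf b) d
  query≤ : ∀ {i k d} → (∀ a → DepthAtMost (k a) d) → DepthAtMost (query i k) (suc d)

-- D_p(n) ≤ d : some deterministic query algorithm of worst-case cost ≤ d
-- decides, for every s ∈ Σ^n, whether p occurs in s.
Dp≤ : {Σ : Set} {m : ℕ} → (Fin m → Σ) → (n : ℕ) → ℕ → Set
Dp≤ {Σ} p n d =
  ∃ λ (T : DTree Σ n) → DepthAtMost T d ×
    (∀ (s : Fin n → Σ) → (eval T s ≡ true) ⇔ Occurs p s)

module Submission where

-- The decision tree keeps a partial record of the characters read so far.
-- It looks at the leftmost window that could still be an occurrence of p
-- and reads the rightmost unread position in it; it accepts once such a
-- window is completely read and rejects when no window is left. Two
-- invariants hold: every read position lies inside every surviving window,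
-- and every surviving window j has at least j mod c unread positions to its
-- left. The second one survives a query at z in window x because a window j
-- with z < j < x + m overlaps window x in read positions only, which makes
-- j − x a period of p, hence a multiple of c. When a query is made, window x
-- has at least (x mod c) + 1 unread positions to the left of x + m, and all
-- n − (x + m) positions beyond are unread, so since c ∣ m at least
-- (n mod c) + 1 positions are unread: the number of unread positions minus
-- n mod c bounds the remaining number of queries.

open import Defs
open import Data.Nat
  using (ℕ; zero; suc; _+_; _∸_; _≤_; _<_; _≤′_; ≤′-refl; ≤′-step; z≤n; s≤s;
         _≟_; _<?_; _≤?_; NonZero)
open import Data.Nat.Properties
open import Data.Nat.DivMod using (_%_; [m+kn]%n≡m%n; m%n≤m; %-distribˡ-+)
open import Data.Nat.Divisibility using (_∣_; divides)
open import Data.Fin using (Fin; fromℕ<)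
open import Data.Maybe using (Maybe; just; nothing)
open import Data.Maybe.Properties using (just-injective; ≡-dec)
open import Data.Bool using (true; false)
open import Data.Product using (_×_; _,_; proj₁; proj₂; ∃)
open import Data.Sum using (_⊎_; inj₁; inj₂)
open import Data.Unit using (⊤; tt)
open import Data.Empty using (⊥-elim)
open import Relation.Nullary using (Dec; yes; no; ¬_)
open import Relation.Nullary.Decidable using (map′; _×-dec_)
open import Relation.Nullary.Negation using (contradiction)
open import Relation.Unary using (Decidable)
open import Relation.Binary using (DecidableEquality)
open import Relation.Binary.PropositionalEquality
open import Algebra.Properties.CommutativeSemigroup +-commutativeSemigroup using (x∙yz≈y∙xz)
open import Function.Bundles using (mk⇔)

∀<-suc : ∀ {q} {Q : ℕ → Set q} {b} →
         (∀ {j} → j < b → Q j) → Q b → ∀ {j} → j < suc b → Q j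
∀<-suc all<b Qb j<1+b with m<1+n⇒m<n∨m≡n j<1+b
... | inj₁ j<b  = all<b j<b
... | inj₂ refl = Qb

module _ {q} {Q : ℕ → Set q} (Q? : Decidable Q) where

  least? : ∀ b → (∃ λ k → k < b × Q k × (∀ {j} → j < k → ¬ Q j))
               ⊎ (∀ {j} → j < b → ¬ Q j)
  least? zero = inj₂ λ ()
  least? (suc b) with least? b
  ... | inj₁ (k , k<b , Qk , min) = inj₁ (k , m<n⇒m<1+n k<b , Qk , min)
  ... | inj₂ none with Q? b
  ...   | yes Qb = inj₁ (b , ≤-refl , Qb , none)
  ...   | no ¬Qb = inj₂ (∀<-suc none ¬Qb)

  greatest? : ∀ b → (∃ λ k → k < b × Q k × (∀ {j} → k < j → j < b → ¬ Q j))
                  ⊎ (∀ {j} → j < b → ¬ Q j)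
  greatest? zero = inj₂ λ ()
  greatest? (suc b) with Q? b
  ... | yes Qb = inj₁ (b , ≤-refl , Qb , λ b<j j<1+b _ → <⇒≱ b<j (≤-pred j<1+b))
  ... | no ¬Qb with greatest? b
  ...   | inj₁ (k , k<b , Qk , max) =
    inj₁ (k , m<n⇒m<1+n k<b , Qk ,
          λ k<j j<1+b → ∀<-suc {Q = λ j → k < j → ¬ Q j}
                              (λ j<b k<j′ → max k<j′ j<b) (λ _ → ¬Qb) j<1+b k<j)
  ...   | inj₂ none = inj₂ (∀<-suc none ¬Qb)

[m+n]%o≤m+n%o : ∀ m n o .{{_ : NonZero o}} → (m + n) % o ≤ m + n % o
[m+n]%o≤m+n%o m n o = begin
  (m + n) % o          ≡⟨ %-distribˡ-+ m n o ⟩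
  (m % o + n % o) % o  ≤⟨ m%n≤m _ o ⟩
  m % o + n % o        ≤⟨ +-monoˡ-≤ (n % o) (m%n≤m m o) ⟩
  m + n % o            ∎
  where open ≤-Reasoning

[x+d]%c≡x%c : ∀ {c d} .{{_ : NonZero c}} → c ∣ d → ∀ x → (x + d) % c ≡ x % c
[x+d]%c≡x%c {c} (divides k refl) x = [m+kn]%n≡m%n x k c

y%c≤[y∸[x+d]]+x%c : ∀ {c d} .{{_ : NonZero c}} → c ∣ d →
                    ∀ {x y} → x + d ≤ y → y % c ≤ (y ∸ (x + d)) + x % c
y%c≤[y∸[x+d]]+x%c {c} {d} c∣d {x} {y} x+d≤y = begin
  y % c              ≡⟨ cong (_% c) (m∸n+n≡m x+d≤y) ⟨
  (e + (x + d)) % c  ≡⟨ cong (_% c) (+-assoc e x d) ⟨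
  (e + x + d) % c    ≡⟨ [x+d]%c≡x%c c∣d (e + x) ⟩
  (e + x) % c        ≤⟨ [m+n]%o≤m+n%o e x c ⟩
  e + x % c          ∎
  where
  open ≤-Reasoning
  e = y ∸ (x + d)

Knowledge : Set → Set
Knowledge A = ℕ → Maybe A

module _ {A : Set} where

  ∅ : Knowledge A
  ∅ _ = nothing

  _[_]≔_ : Knowledge A → ℕ → A → Knowledge A
  (K [ z ]≔ a) y with y ≟ z
  ... | yes _ = just a
  ... | no  _ = K y

  []≔-same : ∀ K z {a} → (K [ z ]≔ a) z ≡ just a
  []≔-same K z with z ≟ z
  ... | yes _   = refl
  ... | no  z≢z = contradiction refl z≢z

  []≔-other : ∀ K {z a y} → y ≢ z → (K [ z ]≔ a) y ≡ K y
  []≔-other K {z} {y = y} y≢z with y ≟ z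
  ... | yes y≡z = contradiction y≡z y≢z
  ... | no  _   = refl

  isUnknown : Maybe A → ℕ
  isUnknown nothing  = 1
  isUnknown (just _) = 0

  unknownsBelow : Knowledge A → ℕ → ℕ
  unknownsBelow K zero    = 0
  unknownsBelow K (suc j) = isUnknown (K j) + unknownsBelow K j

  unknownsBelow-∅ : ∀ j → unknownsBelow ∅ j ≡ j
  unknownsBelow-∅ zero    = refl
  unknownsBelow-∅ (suc j) = cong suc (unknownsBelow-∅ j)

  unknownsBelow-suc : ∀ K {z} → K z ≡ nothing →
                      unknownsBelow K (suc z) ≡ suc (unknownsBelow K z)
  unknownsBelow-suc K {z} Kz≡nothing = cong (λ v → isUnknown v + unknownsBelow K z) Kz≡nothing

  unknownsBelow-mono : ∀ K {a b} → a ≤ b → unknownsBelow K a ≤ unknownsBelow K b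
  unknownsBelow-mono K a≤b = go (≤⇒≤′ a≤b)
    where
    go : ∀ {a b} → a ≤′ b → unknownsBelow K a ≤ unknownsBelow K b
    go ≤′-refl        = ≤-refl
    go (≤′-step a≤′b) = ≤-trans (go a≤′b) (m≤n+m _ _)

  unknownsBelow-tail : ∀ K {a} → (∀ {y} → a ≤ y → K y ≡ nothing) →
                       ∀ e → unknownsBelow K (e + a) ≡ e + unknownsBelow K a
  unknownsBelow-tail K unknown≥a zero    = refl
  unknownsBelow-tail K {a} unknown≥a (suc e) =
    cong₂ _+_ (cong isUnknown (unknown≥a (m≤n+m a e))) (unknownsBelow-tail K unknown≥a e)

  unknownsBelow-[]≔-≤ : ∀ K {z a j} → j ≤ z →
                        unknownsBelow (K [ z ]≔ a) j ≡ unknownsBelow K j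
  unknownsBelow-[]≔-≤ K {j = zero}  _   = refl
  unknownsBelow-[]≔-≤ K {j = suc j} j<z =
    cong₂ _+_ (cong isUnknown ([]≔-other K (<⇒≢ j<z))) (unknownsBelow-[]≔-≤ K (<⇒≤ j<z))

  unknownsBelow-[]≔-> : ∀ K {z a j} → K z ≡ nothing → z < j →
                        unknownsBelow K j ≡ suc (unknownsBelow (K [ z ]≔ a) j)
  unknownsBelow-[]≔-> K {z} {a} {suc j} Kz≡nothing z<1+j with m<1+n⇒m<n∨m≡n z<1+j
  ... | inj₁ z<j = trans
    (cong₂ _+_ (cong isUnknown (sym ([]≔-other K (>⇒≢ z<j))))
               (unknownsBelow-[]≔-> K Kz≡nothing z<j))
    (+-suc _ _)
  ... | inj₂ refl = begin
    unknownsBelow K (suc z)         ≡⟨ unknownsBelow-suc K Kz≡nothing ⟩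
    suc (unknownsBelow K z)         ≡⟨ cong suc (unknownsBelow-[]≔-≤ K {z} {a} ≤-refl) ⟨
    suc (unknownsBelow K′ z)        ≡⟨ cong (λ v → suc (isUnknown v + unknownsBelow K′ z))
                                            ([]≔-same K z) ⟨
    suc (unknownsBelow K′ (suc z))  ∎
    where
    open ≡-Reasoning
    K′ = K [ z ]≔ a

Matches : {A : Set} → Maybe A → A → Set
Matches nothing  _ = ⊤
Matches (just v) w = v ≡ w

Matches-just : ∀ {A : Set} {mv : Maybe A} {v w} → mv ≡ just v → Matches mv w → v ≡ w
Matches-just refl v≡w = v≡w

known⇒just : ∀ {A : Set} {mv : Maybe A} → mv ≢ nothing → ∃ λ v → mv ≡ just v
known⇒just {mv = nothing} known = contradiction refl known
known⇒just {mv = just v}  _     = v , refl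

module Matching {A : Set} (_≟ᴬ_ : DecidableEquality A) {m : ℕ} (p : Fin m → A) (n : ℕ) where

  matches? : ∀ mv w → Dec (Matches mv w)
  matches? nothing  _ = yes tt
  matches? (just v) w = v ≟ᴬ w

  Consistent : Knowledge A → ℕ → Set
  Consistent K j = ∀ {i} (i<m : i < m) → Matches (K (j + i)) (p (fromℕ< i<m))

  Candidate : Knowledge A → ℕ → Set
  Candidate K j = j + m ≤ n × Consistent K j

  consistent? : ∀ K j → Dec (Consistent K j)
  consistent? K j = map′ (λ all {i} i<m → all i<m i<m) (λ cons {i} _ i<m → cons i<m)
                         (allUpTo? matchesAt? m)
    where
    matchesAt? : ∀ i → Dec (∀ (i<m : i < m) → Matches (K (j + i)) (p (fromℕ< i<m)))
    matchesAt? i with i <? m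
    ... | no  i≮m = yes λ i<m → contradiction i<m i≮m
    ... | yes i<m = map′
      (λ M i<m′ → subst (λ h → Matches (K (j + i)) (p (fromℕ< h))) (<-irrelevant i<m i<m′) M)
      (λ all → all i<m)
      (matches? (K (j + i)) (p (fromℕ< i<m)))

  candidate? : ∀ K j → Dec (Candidate K j)
  candidate? K j = (j + m ≤? n) ×-dec consistent? K j

  consistent-[]≔⁻ : ∀ {K z a j} → K z ≡ nothing → Consistent (K [ z ]≔ a) j → Consistent K j
  consistent-[]≔⁻ {K} {z} {j = j} Kz≡nothing cons {i} i<m with j + i ≟ z
  ... | yes refl rewrite Kz≡nothing = tt
  ... | no  j+i≢z = subst (λ mv → Matches mv _) ([]≔-other K j+i≢z) (cons i<m)

  candidate-[]≔⁻ : ∀ {K z a j} → K z ≡ nothing → Candidate (K [ z ]≔ a) j → Candidate K j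
  candidate-[]≔⁻ {K} {z} {a} {j} Kz≡nothing (fits , cons) =
    fits , consistent-[]≔⁻ {K} {z} {a} {j} Kz≡nothing cons

  period-from-overlap : ∀ {K x d} → Consistent K x → Consistent K (x + d) → 0 < d → d < m →
                        (∀ {j} → d ≤ j → j < m → K (x + j) ≢ nothing) → IsPeriod p d
  period-from-overlap {K} {x} {d} cons-x cons-x+d 0<d d<m known = 0<d , <⇒≤ d<m , shift
    where
    shift : ∀ i (i<m : i < m) (i+d<m : i + d < m) → p (fromℕ< i<m) ≡ p (fromℕ< i+d<m)
    shift i i<m i+d<m with known⇒just (known (m≤n+m d i) i+d<m)
    ... | v , read =
      trans (sym (Matches-just read′ (cons-x+d i<m))) (Matches-just read (cons-x i+d<m))
      where
      read′ : K (x + d + i) ≡ just v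
      read′ = trans (cong K (trans (+-assoc x d i) (cong (x +_) (+-comm d i)))) read

  record Probe (K : Knowledge A) : Set where
    field
      origin offset : ℕ
      candidate    : Candidate K origin
      leftmost     : ∀ {j} → Candidate K j → origin ≤ j
      offset<m     : offset < m
      unread       : K (origin + offset) ≡ nothing
      rightmost    : ∀ {j} → offset < j → j < m → K (origin + j) ≢ nothing

    position : ℕ
    position = origin + offset

    position<n : position < n
    position<n = <-≤-trans (+-monoʳ-< origin offset<m) (proj₁ candidate)

  open Probe using (position; position<n)

  data Step (K : Knowledge A) : Set where
    reject : (∀ {j} → ¬ Candidate K j) → Step K
    accept : ∀ {x} → Candidate K x → (∀ {i} → i < m → K (x + i) ≢ nothing) → Step K
    probe  : Probe K → Step K

  step : ∀ K → Step K
  step K with least? (candidate? K) (suc n)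
  ... | inj₂ none = reject λ cand → none (s≤s (m+n≤o⇒m≤o _ (proj₁ cand))) cand
  ... | inj₁ (x , _ , cand , min) with greatest? (λ i → ≡-dec _≟ᴬ_ (K (x + i)) nothing) m
  ...   | inj₂ read = accept cand read
  ...   | inj₁ (i , i<m , unread , max) = probe record
    { origin    = x
    ; offset    = i
    ; candidate = cand
    ; leftmost  = λ cand-j → ≮⇒≥ λ j<x → min j<x cand-j
    ; offset<m  = i<m
    ; unread    = unread
    ; rightmost = max
    }

  -- The fuel only ensures termination: each query reads a new one of the
  -- n positions, so fuel suc n never runs out.
  decide : ℕ → Knowledge A → DTree A n
  decide zero    K = leaf false
  decide (suc f) K with step K
  ... | reject _   = leaf false
  ... | accept _ _ = leaf true
  ... | probe P    = query (fromℕ< (position<n P)) λ a → decide f (K [ position P ]≔ a)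

  module Correctness (s : Fin n → A) where

    Agrees : Knowledge A → Set
    Agrees K = ∀ {y v} → K y ≡ just v → (y<n : y < n) → s (fromℕ< y<n) ≡ v

    agrees-[]≔ : ∀ {K z} → Agrees K → (z<n : z < n) → Agrees (K [ z ]≔ s (fromℕ< z<n))
    agrees-[]≔ {K} {z} agrees z<n {y} read y<n with y ≟ z
    ... | yes refl = trans (cong (λ h → s (fromℕ< h)) (<-irrelevant y<n z<n)) (just-injective read)
    ... | no  _    = agrees read y<n

    occurrence⇒candidate : ∀ {K} → Agrees K → Occurs p s → ∃ (Candidate K)
    occurrence⇒candidate {K} agrees (j , fits , occ) = j , fits , cons
      where
      cons : Consistent K j
      cons {i} i<m with K (j + i) in read
      ... | nothing = tt
      ... | just v  = trans (sym (agrees read j+i<n)) (occ i i<m j+i<n)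
        where j+i<n = <-≤-trans (+-monoʳ-< j i<m) fits

    sound : ∀ f K → Agrees K → eval (decide f K) s ≡ true → Occurs p s
    sound zero    K agrees ()
    sound (suc f) K agrees accepted with step K
    sound (suc f) K agrees () | reject _
    sound (suc f) K agrees accepted | accept {x} (fits , cons) read = x , fits , occ
      where
      occ : ∀ i (i<m : i < m) (x+i<n : x + i < n) → s (fromℕ< x+i<n) ≡ p (fromℕ< i<m)
      occ i i<m x+i<n with known⇒just (read i<m)
      ... | v , Kx+i≡v = trans (agrees Kx+i≡v x+i<n) (Matches-just Kx+i≡v (cons i<m))
    sound (suc f) K agrees accepted | probe P =
      sound f _ (agrees-[]≔ agrees (position<n P)) accepted

    complete : ∀ f K → Agrees K → unknownsBelow K n < f → Occurs p s → eval (decide f K) s ≡ true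
    complete zero    K agrees () occ
    complete (suc f) K agrees budget occ with step K
    ... | reject none = contradiction (proj₂ (occurrence⇒candidate agrees occ)) none
    ... | accept _ _  = refl
    ... | probe P     = complete f _ (agrees-[]≔ agrees (position<n P)) budget′ occ
      where
      budget′ : unknownsBelow (K [ position P ]≔ s (fromℕ< (position<n P))) n < f
      budget′ = ≤-pred (subst (_< suc f)
                              (unknownsBelow-[]≔-> K (Probe.unread P) (position<n P)) budget)

  module Cost {c : ℕ} .{{_ : NonZero c}} (c∣periods : ∀ k → IsPeriod p k → c ∣ k) (1≤m : 1 ≤ m)
    where

    c∣m : c ∣ m
    c∣m = c∣periods m (1≤m , ≤-refl , λ i _ i+m<m → contradiction (m≤n+m m i) (<⇒≱ i+m<m))

    residue-beyond : ∀ {K : Knowledge A} {x r} → (∀ {y} → x + m ≤ y → K y ≡ nothing) →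
                     r + x % c ≤ unknownsBelow K (x + m) →
                     ∀ {y} → x + m ≤ y → r + y % c ≤ unknownsBelow K y
    residue-beyond {K} {x} {r} unread≥ window {y} x+m≤y = begin
      r + y % c                      ≤⟨ +-monoʳ-≤ r (y%c≤[y∸[x+d]]+x%c c∣m x+m≤y) ⟩
      r + (e + x % c)                ≡⟨ x∙yz≈y∙xz r e (x % c) ⟩
      e + (r + x % c)                ≤⟨ +-monoʳ-≤ e window ⟩
      e + unknownsBelow K (x + m)    ≡⟨ unknownsBelow-tail K unread≥ e ⟨
      unknownsBelow K (e + (x + m))  ≡⟨ cong (unknownsBelow K) (m∸n+n≡m x+m≤y) ⟩
      unknownsBelow K y              ∎
      where
      open ≤-Reasoning
      e = y ∸ (x + m)

    record Invariant (K : Knowledge A) : Set where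
      field
        read⇒inside      : ∀ {k v j} → K k ≡ just v → Candidate K j → k < j + m
        residue≤unknowns : ∀ {j} → Candidate K j → j % c ≤ unknownsBelow K j

    open Invariant

    invariant-∅ : Invariant (∅ {A})
    invariant-∅ = record
      { read⇒inside      = λ ()
      ; residue≤unknowns = λ {j} _ → subst (j % c ≤_) (sym (unknownsBelow-∅ j)) (m%n≤m j c)
      }

    unread-beyond : ∀ {K x} → Invariant K → Candidate K x → ∀ {y} → x + m ≤ y → K y ≡ nothing
    unread-beyond {K} inv cand {y} x+m≤y with K y in read
    ... | nothing = refl
    ... | just _  = contradiction (read⇒inside inv read cand) (≤⇒≯ x+m≤y)

    probe-bound : ∀ {K} → Invariant K → (P : Probe K) → n % c < unknownsBelow K n
    probe-bound {K} inv P =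
      residue-beyond {r = 1} (unread-beyond inv candidate) window (proj₁ candidate)
      where
      open Probe P hiding (position; position<n)
      window : suc (origin % c) ≤ unknownsBelow K (origin + m)
      window = begin
        suc (origin % c)                    ≤⟨ s≤s (residue≤unknowns inv candidate) ⟩
        suc (unknownsBelow K origin)        ≤⟨ s≤s (unknownsBelow-mono K (m≤m+n origin offset)) ⟩
        suc (unknownsBelow K (position P)) ≡⟨ unknownsBelow-suc K unread ⟨
        unknownsBelow K (suc (position P)) ≤⟨ unknownsBelow-mono K (+-monoʳ-< origin offset<m) ⟩
        unknownsBelow K (origin + m)        ∎
        where open ≤-Reasoning

    module _ {K : Knowledge A} (inv : Invariant K) (P : Probe K) (a : A) where
      open Probe P hiding (position; position<n)

      private
        z  = position P
        K′ = K [ z ]≔ a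

      z<origin+m : z < origin + m
      z<origin+m = +-monoʳ-< origin offset<m

      origin≤ : ∀ {j} → Candidate K′ j → origin ≤ j
      origin≤ cand = leftmost (candidate-[]≔⁻ unread cand)

      residue-origin : origin % c ≤ unknownsBelow K′ origin
      residue-origin = subst (origin % c ≤_) (sym (unknownsBelow-[]≔-≤ K (m≤m+n origin offset)))
                             (residue≤unknowns inv candidate)

      residue-overlap : ∀ {j} → Candidate K′ j → z < j → j < origin + m → j % c ≡ origin % c
      residue-overlap {j} cand z<j j<origin+m = begin
        j % c             ≡⟨ cong (_% c) origin+d≡j ⟨
        (origin + d) % c  ≡⟨ [x+d]%c≡x%c (c∣periods d d-isPeriod) origin ⟩
        origin % c        ∎
        where
        open ≡-Reasoning
        d = j ∸ origin
        origin+d≡j = m+[n∸m]≡n (origin≤ cand)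
        offset<d : offset < d
        offset<d = +-cancelˡ-< origin offset d (subst (z <_) (sym origin+d≡j) z<j)
        d-isPeriod : IsPeriod p d
        d-isPeriod = period-from-overlap {K} {origin} {d} (proj₂ candidate)
          (subst (Consistent K) (sym origin+d≡j) (proj₂ (candidate-[]≔⁻ unread cand)))
          (≤-<-trans z≤n offset<d)
          (+-cancelˡ-< origin d m (subst (_< origin + m) (sym origin+d≡j) j<origin+m))
          (λ d≤i i<m → rightmost (<-≤-trans offset<d d≤i) i<m)

      invariant-[]≔ : Invariant K′
      invariant-[]≔ = record { read⇒inside = inside ; residue≤unknowns = residue }
        where
        inside : ∀ {k v j} → K′ k ≡ just v → Candidate K′ j → k < j + m
        inside {k} read cand with k ≟ z
        ... | yes refl = <-≤-trans z<origin+m (+-monoˡ-≤ m (origin≤ cand))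
        ... | no  _    = read⇒inside inv read (candidate-[]≔⁻ unread cand)

        residue : ∀ {j} → Candidate K′ j → j % c ≤ unknownsBelow K′ j
        residue {j} cand with j ≤? z | j <? origin + m
        ... | yes j≤z | _ = subst (j % c ≤_) (sym (unknownsBelow-[]≔-≤ K j≤z))
                                  (residue≤unknowns inv (candidate-[]≔⁻ unread cand))
        ... | no j≰z | yes j<origin+m = begin
          j % c                   ≡⟨ residue-overlap cand (≰⇒> j≰z) j<origin+m ⟩
          origin % c              ≤⟨ residue-origin ⟩
          unknownsBelow K′ origin ≤⟨ unknownsBelow-mono K′ (origin≤ cand) ⟩
          unknownsBelow K′ j      ∎
          where open ≤-Reasoning
        ... | no _ | no j≮origin+m = residue-beyond {r = 0} unread′ window (≮⇒≥ j≮origin+m)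
          where
          unread′ : ∀ {y} → origin + m ≤ y → K′ y ≡ nothing
          unread′ origin+m≤y = trans ([]≔-other K (>⇒≢ (<-≤-trans z<origin+m origin+m≤y)))
                                     (unread-beyond inv candidate origin+m≤y)
          window : origin % c ≤ unknownsBelow K′ (origin + m)
          window = ≤-trans residue-origin (unknownsBelow-mono K′ (m≤m+n origin m))

    depth : ∀ f K d → Invariant K → unknownsBelow K n ≤ n % c + d → DepthAtMost (decide f K) d
    depth zero    K d inv _ = leaf≤
    depth (suc f) K d inv budget with step K
    ... | reject _   = leaf≤
    ... | accept _ _ = leaf≤
    ... | probe P with d
    ...   | zero  =
      ⊥-elim (<⇒≱ (<-≤-trans (probe-bound inv P) budget) (≤-reflexive (+-identityʳ (n % c))))
    ...   | suc d = query≤ λ a → depth f _ d (invariant-[]≔ inv P a) (budget′ a)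
      where
      budget′ : ∀ a → unknownsBelow (K [ position P ]≔ a) n ≤ n % c + d
      budget′ a = ≤-pred (begin
        suc (unknownsBelow (K [ position P ]≔ a) n)
          ≡⟨ unknownsBelow-[]≔-> K (Probe.unread P) (position<n P) ⟨
        unknownsBelow K n  ≤⟨ budget ⟩
        n % c + suc d      ≡⟨ +-suc (n % c) d ⟩
        suc (n % c + d)    ∎)
        where open ≤-Reasoning

lemma1 : (σ m : ℕ) (p : Fin m → Fin σ) → 1 ≤ m →
         (c : ℕ) → IsGcdOfPeriods p c → .{{_ : NonZero c}} →
         (n : ℕ) → Dp≤ p n (n ∸ (n % c))
lemma1 σ m p 1≤m c (c∣periods , _) n =
  decide (suc n) ∅ ,
  depth (suc n) ∅ (n ∸ n % c) invariant-∅
        (subst (_≤ n % c + (n ∸ n % c)) (sym (unknownsBelow-∅ n)) (m≤n+m∸n n (n % c))) ,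
  λ s → mk⇔ (sound s (suc n) ∅ (λ ()))
            (complete s (suc n) ∅ (λ ()) (subst (_< suc n) (sym (unknownsBelow-∅ n)) ≤-refl))
  where
  open Matching Data.Fin._≟_ p n
  open Cost c∣periods 1≤m
  open Correctness
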